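{- Let $V_n$ be the approximating graphs of the Diamond fractal (defined in the context). Then for all $n\ge1$, $$\tau(V_n)=2^{\frac23(4^n-1)}.$$
   Context: $V_0$ is a single edge joining two vertices $x_1,x_2$. For $n\ge1$, $V_n$ is obtained from $V_{n-1}$ by replacing each edge $\{u,v\}$ by a "diamond": two new vertices $a,b$ (distinct for different edges) and the four edges $ua,av,vb,bu$, the edge $\{u,v\}$ itself being removed. Thus $V_1$ is a 4-cycle and $V_n$ has $4^n$ edges. $\tau(G)$ denotes the number of spanning trees of $G$. -}

module Defs where

open import Data.Nat using (ℕ; zero; suc; _+_; _*_)
open import Data.Fin using (Fin; zero; suc; combine; _↑ˡ_; _↑ʳ_)
open import Data.Fin.Subset using (Subset; _∈_)
open import Data.Vec using (Vec; []; _∷_; concat; map; tabulate; lookup)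
open import Data.Product using (Σ; ∃; _×_; _,_)
open import Data.Sum using (_⊎_)
open import Data.List using (List; []; _∷_)
open import Data.List.Relation.Unary.Unique.Propositional using (Unique)
open import Data.Refinement using (Refinement)
open import Function.Bundles using (_↔_)
open import Relation.Binary.PropositionalEquality using (_≡_)
open import Relation.Nullary using (¬_)

record Graph : Set where
  field
    nV  : ℕ
    nE  : ℕ
    ends : Vec (Fin nV × Fin nV) nE

module _ (G : Graph) where
  open Graph G

  Joins : Fin nE → Fin nV → Fin nV → Set
  Joins e u w = lookup ends e ≡ (u , w) ⊎ lookup ends e ≡ (w , u)

  data Walk (S : Subset nE) : Fin nV → Fin nV → List (Fin nE) → Set where
    nil  : ∀ {u} → Walk S u u []
    cons : ∀ {u w v es} (e : Fin nE) → e ∈ S → Joins e u w →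
           Walk S w v es → Walk S u v (e ∷ es)

  Connected : Subset nE → Set
  Connected S = ∀ u v → ∃ λ es → Walk S u v es

  HasCycle : Subset nE → Set
  HasCycle S = Σ (Fin nV) λ u → Σ (Fin nE) λ e → Σ (List (Fin nE)) λ es →
               Walk S u u (e ∷ es) × Unique (e ∷ es)

  Acyclic : Subset nE → Set
  Acyclic S = ¬ HasCycle S

  IsSpanningTree : Subset nE → Set
  IsSpanningTree S = Connected S × Acyclic S

  SpanningTree : Set
  SpanningTree = Refinement (Subset nE) IsSpanningTree

τ≡ : Graph → ℕ → Set
τ≡ G k = SpanningTree G ↔ Fin k

numE : ℕ → ℕ
numE zero    = 1
numE (suc n) = numE n * 4

numV : ℕ → ℕ
numV zero    = 2
numV (suc n) = numV n + numE n * 2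

-- one diamond replacing edge i = {u,v}, using new vertices a = N+2i, b = N+2i+1
diamond : ∀ {N m} → Fin m → Fin N × Fin N → Vec (Fin (N + m * 2) × Fin (N + m * 2)) 4
diamond {N} {m} i (u , v) =
  (u' , a) ∷ (a , v') ∷ (v' , b) ∷ (b , u') ∷ []
  where
    u' = u ↑ˡ (m * 2)
    v' = v ↑ˡ (m * 2)
    a  = N ↑ʳ combine i zero
    b  = N ↑ʳ combine i (suc zero)

diamondEdges : (n : ℕ) → Vec (Fin (numV n) × Fin (numV n)) (numE n)
diamondEdges zero    = (zero , suc zero) ∷ []
diamondEdges (suc n) =
  concat (tabulate λ i → diamond i (lookup (diamondEdges n) i))

V : ℕ → Graph
V n = record { nV = numV n ; nE = numE n ; ends = diamondEdges n }

-- Let H be obtained from a graph G with m edges by the diamond substitution (every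
-- edge uv becomes the 4-cycle u–a–v–b–u on two fresh vertices a, b).  The heart of
-- the proof is an explicit bijection
--     SpanningTree H  ↔  SpanningTree G × Vec (Fin 4) m .
-- A spanning tree T of H meets each diamond in an "admissible" pattern: not all four
-- edges (that is a cycle), and at least one edge at a and one at b (else a, b would be
-- isolated).  There are exactly 8 such patterns, 4 of them containing a full u–v side
-- (three edges) and 4 containing no full side (two edges, one at a and one at b).
-- Keeping edge uv of G exactly when its diamond contains a full side projects T to a
-- spanning tree of G; the position of the pattern among its four siblings is an
-- element of Fin 4.  Conversely every such choice lifts to a spanning tree of H.
-- Iterating from the single edge V 0 gives τ(V n) = 2 ^ e n with e(n+1) = e n + 2·4ⁿ,
-- and e n = 2(4ⁿ − 1)/3 is elementary arithmetic.
module Submission where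

open import Defs
open import Data.Nat using (ℕ; zero; suc; _+_; _*_; _≤_; _∸_; _^_; _/_)
open import Data.Fin using (Fin; zero; suc; combine; remQuot; _↑ˡ_; _↑ʳ_; splitAt)
open import Data.Fin.Properties
  using (↑ˡ-injective; ↑ʳ-injective; combine-injective; combine-injectiveʳ; remQuot-combine;
         combine-surjective; splitAt-↑ˡ; splitAt-↑ʳ; splitAt⁻¹-↑ˡ; splitAt⁻¹-↑ʳ; *↔×)
open import Data.Fin.Subset using (Subset; _∈_)
open import Data.Vec using (Vec; []; _∷_; concat; tabulate; lookup)
open import Data.Vec.Properties
  using (lookup-concat; lookup∘tabulate; []=⇒lookup; lookup⇒[]=; tabulate∘lookup; tabulate-cong)
open import Data.Product using (Σ; ∃; ∃₂; _×_; _,_; proj₁; proj₂; swap)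
open import Data.Product.Properties using (,-injective)
open import Data.Product.Function.NonDependent.Propositional using (_×-↔_)
open import Data.Sum using (_⊎_; inj₁; inj₂)
open import Data.List using (List; []; _∷_; _++_)
open import Data.List.Relation.Unary.All as All using (All; []; _∷_)
open import Data.List.Relation.Unary.All.Properties using (++⁺)
open import Data.List.Relation.Unary.AllPairs using ([]; _∷_)
open import Data.List.Relation.Unary.Any using (here; there)
open import Data.List.Membership.Propositional renaming (_∈_ to _∈ₗ_)
open import Data.List.Relation.Unary.Unique.Propositional using (Unique)
open import Data.Bool using (Bool; true; false; _∧_; _∨_; not)
open import Data.Bool.Properties using (∨-zeroʳ) renaming (_≟_ to _≟ᵇ_)
open import Data.Empty using (⊥; ⊥-elim)
open import Relation.Binary.PropositionalEquality
open import Relation.Nullary.Decidable.Core using (recompute)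
open import Data.Refinement using (value-injective) renaming (_,_ to _,ʳ_)
open import Data.Irrelevant using ([_]) renaming (map to mapIrr)
open import Function.Bundles using (_↔_; mk↔ₛ′)
open import Function.Properties.Inverse using (↔-trans; ↔-sym; ↔-refl)
open import Data.Nat.Properties using (*-comm; ^-distribˡ-+-*; ^-*-assoc; *-distribˡ-∸; m+n∸n≡m)
open import Data.Nat.DivMod using (m*n/n≡m)
open import Data.Nat.Solver using (module +-*-Solver)

module Walks (G : Graph) where
  joins-sym : ∀ {e u w} → Joins G e u w → Joins G e w u
  joins-sym (inj₁ p) = inj₂ p
  joins-sym (inj₂ p) = inj₁ p

  joins-unique : ∀ {e u w x y} → Joins G e u w → Joins G e x y →
                 (u ≡ x × w ≡ y) ⊎ (u ≡ y × w ≡ x)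
  joins-unique (inj₁ p) (inj₁ q) = inj₁ (,-injective (trans (sym p) q))
  joins-unique (inj₁ p) (inj₂ q) = inj₂ (,-injective (trans (sym p) q))
  joins-unique (inj₂ p) (inj₁ q) = inj₂ (swap (,-injective (trans (sym p) q)))
  joins-unique (inj₂ p) (inj₂ q) = inj₁ (swap (,-injective (trans (sym p) q)))

  _++ʷ_ : ∀ {S u v w es fs} → Walk G S u v es → Walk G S v w fs → Walk G S u w (es ++ fs)
  nil           ++ʷ q = q
  cons e p j w  ++ʷ q = cons e p j (w ++ʷ q)

  reverseʷ : ∀ {S u v es} → Walk G S u v es → ∃ λ fs → Walk G S v u fs
  reverseʷ nil = [] , nil
  reverseʷ (cons e p j w) with reverseʷ w
  ... | fs , w′ = fs ++ e ∷ [] , w′ ++ʷ cons e p (joins-sym j) nil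

  unique-snoc : ∀ {A : Set} {e : A} {es} → All (e ≢_) es → Unique es → Unique (es ++ e ∷ [])
  unique-snoc [] [] = [] ∷ []
  unique-snoc (e≢x ∷ e≢xs) (x∉xs ∷ u) =
    ++⁺ x∉xs ((λ eq → e≢x (sym eq)) ∷ []) ∷ unique-snoc e≢xs u

  rotate : ∀ {S u e es} → Walk G S u u (e ∷ es) → Unique (e ∷ es) →
           ∃ λ z → Σ _ λ e′ → Σ _ λ es′ →
             Walk G S z z (e′ ∷ es′) × Unique (e′ ∷ es′) × Joins G e u z
  rotate {es = []}     (cons e p j w) (e∉ ∷ u) = _ , e , [] , w ++ʷ cons e p j nil , [] ∷ [] , j
  rotate {es = x ∷ xs} (cons e p j w) (e∉ ∷ u) =
    _ , x , xs ++ e ∷ [] , w ++ʷ cons e p j nil , unique-snoc e∉ u , j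

-- The four edges of a diamond on uv are numbered 0 : ua, 1 : av, 2 : vb, 3 : bu.
-- Edges 0, 1 form the side through a (side 0), edges 2, 3 the side through b (side 1).
pattern ua = zero
pattern av = suc zero
pattern vb = suc (suc zero)
pattern bu = suc (suc (suc zero))

pattern sideA = zero
pattern sideB = suc zero

side : Fin 4 → Fin 2
side ua = sideA
side av = sideA
side vb = sideB
side bu = sideB

-- Two distinct edges of the same side, named by the u–v path of length two they form.
data Partners : Fin 4 → Fin 4 → Set where
  uav : Partners ua av
  vau : Partners av ua
  vbu : Partners vb bu
  ubv : Partners bu vb

partners-side : ∀ {k k′} → Partners k k′ → side k ≡ side k′
partners-side uav = refl
partners-side vau = refl
partners-side vbu = refl
partners-side ubv = refl

partners-unique : ∀ {k k′ k″} → Partners k k′ → Partners k′ k″ → k ≡ k″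
partners-unique uav vau = refl
partners-unique vau uav = refl
partners-unique vbu ubv = refl
partners-unique ubv vbu = refl

same-side : ∀ k k′ → side k ≡ side k′ → k ≡ k′ ⊎ Partners k k′
same-side ua ua _ = inj₁ refl
same-side ua av _ = inj₂ uav
same-side av ua _ = inj₂ vau
same-side av av _ = inj₁ refl
same-side vb vb _ = inj₁ refl
same-side vb bu _ = inj₂ vbu
same-side bu vb _ = inj₂ ubv
same-side bu bu _ = inj₁ refl
same-side ua vb ()
same-side ua bu ()
same-side av vb ()
same-side av bu ()
same-side vb ua ()
same-side vb av ()
same-side bu ua ()
same-side bu av ()

∧-split : ∀ {a b} → a ∧ b ≡ true → a ≡ true × b ≡ true
∧-split {true} {true} refl = refl , refl

∧-intro : ∀ {a b} → a ≡ true → b ≡ true → a ∧ b ≡ true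
∧-intro refl refl = refl

∨-split : ∀ {a b} → a ∨ b ≡ true → a ≡ true ⊎ b ≡ true
∨-split {true}  _ = inj₁ refl
∨-split {false} e = inj₂ e

not-both : ∀ a b → (a ≡ true → b ≡ true → ⊥) → not (a ∧ b) ≡ true
not-both true  true  ¬ab = ⊥-elim (¬ab refl refl)
not-both true  false _   = refl
not-both false _     _   = refl

not-both⁻ : ∀ {a b} → not (a ∧ b) ≡ true → a ≡ true → b ≡ true → ⊥
not-both⁻ () refl refl

-- A choice of edges in one diamond is a Boolean quadruple.  It is admissible if it is
-- not the whole 4-cycle and touches both middle vertices; it carries uv if it
-- contains a full side.  Admissible quadruples are encoded by (carries, code).
Quad : Set
Quad = Vec Bool 4

admissible : Quad → Bool
admissible (b0 ∷ b1 ∷ b2 ∷ b3 ∷ []) = not ((b0 ∧ b1) ∧ (b2 ∧ b3)) ∧ ((b0 ∨ b1) ∧ (b2 ∨ b3))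

carries : Quad → Bool
carries (b0 ∷ b1 ∷ b2 ∷ b3 ∷ []) = (b0 ∧ b1) ∨ (b2 ∧ b3)

admissible-intro : ∀ (β : Fin 4 → Bool) → (β ua ∧ β av ≡ true → β vb ∧ β bu ≡ true → ⊥) →
                   β ua ∨ β av ≡ true → β vb ∨ β bu ≡ true → admissible (tabulate β) ≡ true
admissible-intro β ¬full a b = ∧-intro (not-both (β ua ∧ β av) (β vb ∧ β bu) ¬full) (∧-intro a b)

admissible-not-full : ∀ (β : Fin 4 → Bool) → admissible (tabulate β) ≡ true →
                      β ua ∧ β av ≡ true → β vb ∧ β bu ≡ true → ⊥
admissible-not-full β adm = not-both⁻ (proj₁ (∧-split adm))

admissible-touches : ∀ (β : Fin 4 → Bool) → admissible (tabulate β) ≡ true →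
                     β ua ∨ β av ≡ true × β vb ∨ β bu ≡ true
admissible-touches β adm = ∧-split (proj₂ (∧-split {not ((β ua ∧ β av) ∧ (β vb ∧ β bu))} adm))

code : Quad → Fin 4
code (true  ∷ true  ∷ false ∷ true  ∷ []) = av
code (true  ∷ false ∷ true  ∷ true  ∷ []) = vb
code (true  ∷ false ∷ false ∷ true  ∷ []) = av
code (false ∷ true  ∷ true  ∷ true  ∷ []) = bu
code (false ∷ true  ∷ true  ∷ false ∷ []) = vb
code (false ∷ true  ∷ false ∷ true  ∷ []) = bu
code _                                    = ua

decode : Bool → Fin 4 → Quad
decode true  ua = true  ∷ true  ∷ true  ∷ false ∷ []
decode true  av = true  ∷ true  ∷ false ∷ true  ∷ []
decode true  vb = true  ∷ false ∷ true  ∷ true  ∷ []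
decode true  bu = false ∷ true  ∷ true  ∷ true  ∷ []
decode false ua = true  ∷ false ∷ true  ∷ false ∷ []
decode false av = true  ∷ false ∷ false ∷ true  ∷ []
decode false vb = false ∷ true  ∷ true  ∷ false ∷ []
decode false bu = false ∷ true  ∷ false ∷ true  ∷ []

decode-code : ∀ q → admissible q ≡ true → decode (carries q) (code q) ≡ q
decode-code (true  ∷ true  ∷ true  ∷ true  ∷ []) ()
decode-code (true  ∷ true  ∷ false ∷ false ∷ []) ()
decode-code (true  ∷ false ∷ false ∷ false ∷ []) ()
decode-code (false ∷ true  ∷ false ∷ false ∷ []) ()
decode-code (false ∷ false ∷ _     ∷ _     ∷ []) ()
decode-code (true  ∷ true  ∷ true  ∷ false ∷ []) refl = refl
decode-code (true  ∷ true  ∷ false ∷ true  ∷ []) refl = refl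
decode-code (true  ∷ false ∷ true  ∷ true  ∷ []) refl = refl
decode-code (true  ∷ false ∷ true  ∷ false ∷ []) refl = refl
decode-code (true  ∷ false ∷ false ∷ true  ∷ []) refl = refl
decode-code (false ∷ true  ∷ true  ∷ true  ∷ []) refl = refl
decode-code (false ∷ true  ∷ true  ∷ false ∷ []) refl = refl
decode-code (false ∷ true  ∷ false ∷ true  ∷ []) refl = refl

code-decode : ∀ c k → carries (decode c k) ≡ c × code (decode c k) ≡ k × admissible (decode c k) ≡ true
code-decode true  ua = refl , refl , refl
code-decode true  av = refl , refl , refl
code-decode true  vb = refl , refl , refl
code-decode true  bu = refl , refl , refl
code-decode false ua = refl , refl , refl
code-decode false av = refl , refl , refl
code-decode false vb = refl , refl , refl
code-decode false bu = refl , refl , refl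

vec-ext : ∀ {A : Set} {n} {u v : Vec A n} → (∀ i → lookup u i ≡ lookup v i) → u ≡ v
vec-ext {u = u} {v} same =
  trans (sym (tabulate∘lookup u)) (trans (tabulate-cong same) (tabulate∘lookup v))

-- The diamond substitution of an arbitrary graph; by definition V (suc n) is
-- `substitute (V n)`.  Edge i of G gives edges combine i k, k : Fin 4, and middle
-- vertices nV ↑ʳ combine i s, s : Fin 2.
substitute : Graph → Graph
substitute G = record
  { nV   = nV + nE * 2
  ; nE   = nE * 4
  ; ends = concat (tabulate λ i → diamond i (lookup ends i))
  }
  where open Graph G

module Substitution (G : Graph) where
  open Graph G

  H : Graph
  H = substitute G

  open Walks H

  old : Fin nV → Fin (nV + nE * 2)
  old x = x ↑ˡ (nE * 2)

  mid : Fin nE → Fin 2 → Fin (nV + nE * 2)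
  mid i s = nV ↑ʳ combine i s

  corner : Fin nE → Fin 4 → Fin nV
  corner i ua = proj₁ (lookup ends i)
  corner i av = proj₂ (lookup ends i)
  corner i vb = proj₂ (lookup ends i)
  corner i bu = proj₁ (lookup ends i)

  joins-corner : ∀ i k → Joins H (combine i k) (old (corner i k)) (mid i (side k))
  joins-corner i k = orient k
    where
    ends-H : ∀ k → lookup (Graph.ends H) (combine i k) ≡ lookup (diamond i (lookup ends i)) k
    ends-H k = trans (lookup-concat (tabulate λ i → diamond i (lookup ends i)) i k)
                     (cong (λ v → lookup v k) (lookup∘tabulate (λ i → diamond i (lookup ends i)) i))
    orient : ∀ k → Joins H (combine i k) (old (corner i k)) (mid i (side k))
    orient ua = inj₁ (ends-H ua)
    orient av = inj₂ (ends-H av)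
    orient vb = inj₁ (ends-H vb)
    orient bu = inj₂ (ends-H bu)

  old≢mid : ∀ {x i s} → old x ≢ mid i s
  old≢mid {x} {i} {s} eq with trans (sym (splitAt-↑ˡ nV x (nE * 2)))
                                    (trans (cong (splitAt nV) eq) (splitAt-↑ʳ nV (nE * 2) (combine i s)))
  ... | ()

  old-injective : ∀ {x y} → old x ≡ old y → x ≡ y
  old-injective {x} {y} = ↑ˡ-injective (nE * 2) x y

  mid-injective : ∀ {i s j t} → mid i s ≡ mid j t → i ≡ j × s ≡ t
  mid-injective {i} {s} {j} {t} eq = combine-injective i s j t (↑ʳ-injective nV _ _ eq)

  vertex-view : (X : Fin (nV + nE * 2)) → (∃ λ x → X ≡ old x) ⊎ (∃₂ λ i s → X ≡ mid i s)
  vertex-view X with splitAt nV X in eq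
  ... | inj₁ x = inj₁ (x , sym (splitAt⁻¹-↑ˡ eq))
  ... | inj₂ y with combine-surjective {nE} {2} y
  ...   | i , s , refl = inj₂ (i , s , sym (splitAt⁻¹-↑ʳ eq))

  leave-old : ∀ {x Z e} → Joins H e (old x) Z →
              ∃₂ λ i k → e ≡ combine i k × x ≡ corner i k × Z ≡ mid i (side k)
  leave-old {e = e} j with combine-surjective {nE} {4} e
  ... | i , k , refl with joins-unique j (joins-corner i k)
  ...   | inj₁ (x≡ , Z≡) = i , k , refl , old-injective x≡ , Z≡
  ...   | inj₂ (x≡ , _)  = ⊥-elim (old≢mid x≡)

  leave-mid : ∀ {i h Z e} → Joins H e (mid i h) Z →
              ∃ λ k → e ≡ combine i k × h ≡ side k × Z ≡ old (corner i k)
  leave-mid {e = e} j with combine-surjective {nE} {4} e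
  ... | i′ , k , refl with joins-unique j (joins-corner i′ k)
  ...   | inj₁ (X≡ , _)  = ⊥-elim (old≢mid (sym X≡))
  ...   | inj₂ (X≡ , Z≡) with mid-injective X≡
  ...     | refl , refl = k , refl , refl , Z≡

  cross : ∀ {x Z Y e e′} → Joins H e (old x) Z → Joins H e′ Z Y →
          ∃₂ λ i k → ∃ λ k′ → e ≡ combine i k × e′ ≡ combine i k′ ×
                              x ≡ corner i k × Y ≡ old (corner i k′) × (k ≡ k′ ⊎ Partners k k′)
  cross j j′ with leave-old j
  ... | i , k , refl , refl , refl with leave-mid j′
  ...   | k′ , refl , eh , refl = i , k , k′ , refl , refl , refl , refl , same-side k k′ eh

  module _ (T : Subset (nE * 4)) where
    kept : Fin nE → Fin 4 → Bool
    kept i k = lookup T (combine i k)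

    window : Fin nE → Quad
    window i = tabulate (kept i)

    full : Fin nE → Fin 2 → Bool
    full i sideA = kept i ua ∧ kept i av
    full i sideB = kept i vb ∧ kept i bu

    touched : Fin nE → Fin 2 → Bool
    touched i sideA = kept i ua ∨ kept i av
    touched i sideB = kept i vb ∨ kept i bu

    proj : Subset nE
    proj = tabulate λ i → carries (window i)

    ∈T⇒kept : ∀ {e} → e ∈ T → lookup T e ≡ true
    ∈T⇒kept = []=⇒lookup

    kept⇒∈T : ∀ {e} → lookup T e ≡ true → e ∈ T
    kept⇒∈T {e} = lookup⇒[]= e T

    full⇒∈proj : ∀ i h → full i h ≡ true → i ∈ proj
    full⇒∈proj i h eq = lookup⇒[]= i proj (trans (lookup∘tabulate _ i) (either h eq))
      where
      either : ∀ h → full i h ≡ true → full i sideA ∨ full i sideB ≡ true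
      either sideA eq rewrite eq = refl
      either sideB eq rewrite eq = ∨-zeroʳ _

    ∈proj⇒full : ∀ {i} → i ∈ proj → full i sideA ≡ true ⊎ full i sideB ≡ true
    ∈proj⇒full {i} p = ∨-split (trans (sym (lookup∘tabulate _ i)) ([]=⇒lookup p))

    kept⇒touched : ∀ i k → kept i k ≡ true → touched i (side k) ≡ true
    kept⇒touched i ua b rewrite b = refl
    kept⇒touched i av b rewrite b = ∨-zeroʳ _
    kept⇒touched i vb b rewrite b = refl
    kept⇒touched i bu b rewrite b = ∨-zeroʳ _

    touched⇒kept : ∀ i h → touched i h ≡ true → ∃ λ k → side k ≡ h × kept i k ≡ true
    touched⇒kept i sideA t with ∨-split t
    ... | inj₁ b = ua , refl , b
    ... | inj₂ b = av , refl , b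
    touched⇒kept i sideB t with ∨-split t
    ... | inj₁ b = vb , refl , b
    ... | inj₂ b = bu , refl , b

    admissible⇒touched : ∀ i → admissible (window i) ≡ true → ∀ h → touched i h ≡ true
    admissible⇒touched i adm sideA = proj₁ (admissible-touches (kept i) adm)
    admissible⇒touched i adm sideB = proj₂ (admissible-touches (kept i) adm)

    partners-full : ∀ {i k k′} → Partners k k′ → kept i k ≡ true → kept i k′ ≡ true →
                    full i (side k) ≡ true
    partners-full uav b b′ rewrite b | b′ = refl
    partners-full vau b b′ rewrite b | b′ = refl
    partners-full vbu b b′ rewrite b | b′ = refl
    partners-full ubv b b′ rewrite b | b′ = refl

    partners-join : ∀ {i k k′} → Partners k k′ → Joins G i (corner i k) (corner i k′)
    partners-join uav = inj₁ refl
    partners-join vau = inj₂ refl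
    partners-join vbu = inj₂ refl
    partners-join ubv = inj₁ refl

    partners-∈proj : ∀ {i k k′} → Partners k k′ → combine i k ∈ T → combine i k′ ∈ T → i ∈ proj
    partners-∈proj {i} {k} pk p p′ = full⇒∈proj i (side k) (partners-full pk (∈T⇒kept p) (∈T⇒kept p′))

    -- A walk of H in T between old vertices projects to a walk of G in proj T: it
    -- passes through diamonds along two partner edges (a full side) or turns back.
    project-walk : ∀ {X Y es} → Walk H T X Y es → ∀ x y → X ≡ old x → Y ≡ old y →
                   ∃ λ fs → Walk G proj x y fs
    project-walk nil x y refl eY with old-injective eY
    ... | refl = [] , nil
    project-walk (cons e p j nil) x y refl eY with leave-old j
    ... | i , k , refl , refl , refl = ⊥-elim (old≢mid (sym eY))
    project-walk (cons e p j (cons e′ p′ j′ w)) x y refl eY with cross j j′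
    ... | i , k , k′ , refl , refl , refl , refl , turn with project-walk w (corner i k′) y refl eY | turn
    ...   | fs , W | inj₁ refl = fs , W
    ...   | fs , W | inj₂ pk =
      i ∷ fs , cons i (partners-∈proj pk p p′) (partners-join pk) W

    corner→mid : ∀ {i k Y es} → kept i k ≡ true →
                 Walk H T (mid i (side k)) Y es → Walk H T (old (corner i k)) Y (combine i k ∷ es)
    corner→mid {i} {k} b = cons _ (kept⇒∈T b) (joins-corner i k)

    mid→corner : ∀ {i k Y es} → kept i k ≡ true →
                 Walk H T (old (corner i k)) Y es → Walk H T (mid i (side k)) Y (combine i k ∷ es)
    mid→corner {i} {k} b = cons _ (kept⇒∈T b) (joins-sym (joins-corner i k))

    partners-walk : ∀ {i k k′} → Partners k k′ → kept i k ≡ true → kept i k′ ≡ true →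
                    Walk H T (old (corner i k)) (old (corner i k′)) (combine i k ∷ combine i k′ ∷ [])
    partners-walk {i} {k} {k′} pk b b′ =
      corner→mid b (subst (λ h → Walk H T (mid i h) _ _) (sym (partners-side pk)) (mid→corner b′ nil))

    lift-edge : ∀ {i x z} → i ∈ proj → Joins G i x z →
                ∃₂ λ k k′ → k ≢ k′ × Walk H T (old x) (old z) (combine i k ∷ combine i k′ ∷ [])
    lift-edge {i} p j with ∈proj⇒full p | j
    ... | inj₁ f | inj₁ refl = _ , _ , (λ ()) , partners-walk uav (proj₁ (∧-split f)) (proj₂ (∧-split f))
    ... | inj₁ f | inj₂ refl = _ , _ , (λ ()) , partners-walk vau (proj₂ (∧-split f)) (proj₁ (∧-split f))
    ... | inj₂ f | inj₁ refl = _ , _ , (λ ()) , partners-walk ubv (proj₂ (∧-split f)) (proj₁ (∧-split f))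
    ... | inj₂ f | inj₂ refl = _ , _ , (λ ()) , partners-walk vbu (proj₁ (∧-split f)) (proj₂ (∧-split f))

    InDiamonds : List (Fin nE) → Fin (nE * 4) → Set
    InDiamonds fs e = ∃₂ λ j k → e ≡ combine j k × j ∈ₗ fs

    outside : ∀ {i k fs es} → All (i ≢_) fs → All (InDiamonds fs) es → All (combine i k ≢_) es
    outside i∉fs = All.map λ { (j , k′ , refl , j∈fs) eq →
                                 All.lookup i∉fs j∈fs (proj₁ (combine-injective _ _ _ _ eq)) }

    unique-prepend : ∀ {i k k′ fs es} → k ≢ k′ → Unique (i ∷ fs) → (Unique fs → Unique es) →
                     All (InDiamonds fs) es → Unique (combine i k ∷ combine i k′ ∷ es)
    unique-prepend {i} {k} {k′} k≢k′ (i∉fs ∷ u) lift-u inside =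
      ((λ eq → k≢k′ (combine-injectiveʳ i k i k′ eq)) ∷ outside i∉fs inside) ∷
      (outside i∉fs inside ∷ lift-u u)

    lift-walk : ∀ {x y fs} → Walk G proj x y fs →
                ∃ λ es → Walk H T (old x) (old y) es × (Unique fs → Unique es) × All (InDiamonds fs) es
    lift-walk nil = [] , nil , (λ _ → []) , []
    lift-walk (cons i p j w) with lift-edge p j | lift-walk w
    ... | k , k′ , k≢k′ , W₂ | es , W , lift-u , inside =
      _ , W₂ ++ʷ W , (λ u → unique-prepend k≢k′ u lift-u inside) ,
      ((i , k , refl , here refl) ∷ (i , k′ , refl , here refl) ∷
       All.map (λ { (j , k″ , eq , j∈fs) → j , k″ , eq , there j∈fs }) inside)

    lift-cycle : HasCycle G proj → HasCycle H T
    lift-cycle (u , i , fs , cons _ p j w , U) with lift-edge p j | lift-walk w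
    ... | k , k′ , k≢k′ , W₂ | es , W , lift-u , inside =
      old u , combine i k , combine i k′ ∷ es , W₂ ++ʷ W , unique-prepend k≢k′ U lift-u inside

    module _ (one-side : ∀ i → full i sideA ≡ true → full i sideB ≡ true → ⊥) where
      full-sides-agree : ∀ i h h′ → full i h ≡ true → full i h′ ≡ true → h ≡ h′
      full-sides-agree i sideA sideA _ _  = refl
      full-sides-agree i sideA sideB f f′ = ⊥-elim (one-side i f f′)
      full-sides-agree i sideB sideA f f′ = ⊥-elim (one-side i f′ f)
      full-sides-agree i sideB sideB _ _  = refl

      full-side-edges : ∀ {i k₁ k₂} → Partners k₁ k₂ → kept i k₁ ≡ true → kept i k₂ ≡ true →
                        ∀ k → full i (side k) ≡ true → k ≡ k₁ ⊎ k ≡ k₂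
      full-side-edges {i} pk b₁ b₂ k f
        with same-side k _ (full-sides-agree i _ _ f (partners-full pk b₁ b₂))
      ... | inj₁ k≡k₁ = inj₁ k≡k₁
      ... | inj₂ pk′  = inj₂ (partners-unique pk′ pk)

      Shadow : Fin nV → Fin nV → List (Fin (nE * 4)) → Set
      Shadow x y es = Σ (Fin nE) λ i → Σ (List (Fin nE)) λ fs →
        Walk G proj x y (i ∷ fs) × Unique (i ∷ fs) ×
        (∀ {j} → j ∈ₗ i ∷ fs → ∃ λ k → combine j k ∈ₗ es × full j (side k) ≡ true)

      -- A nonempty trail of H in T between old vertices has a shadow: it cannot turn
      -- back inside a diamond, and it cannot revisit a diamond, since a second passage
      -- would reuse one of the two kept edges of the unique full side.
      project-trail : ∀ {X Y e es} → Walk H T X Y (e ∷ es) → Unique (e ∷ es) →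
                      ∀ x y → X ≡ old x → Y ≡ old y → Shadow x y (e ∷ es)
      project-trail (cons e p j nil) U x y refl eY with leave-old j
      ... | i , k , refl , refl , refl = ⊥-elim (old≢mid (sym eY))
      project-trail (cons e p j (cons e′ p′ j′ nil)) ((e≢e′ ∷ _) ∷ _) x y refl eY with cross j j′
      ... | i , k , k′ , refl , refl , refl , refl , inj₁ refl = ⊥-elim (e≢e′ refl)
      ... | i , k , k′ , refl , refl , refl , refl , inj₂ pk with old-injective eY
      ...   | refl = i , [] , cons i (partners-∈proj pk p p′) (partners-join pk) nil , [] ∷ [] ,
        λ { (here refl) → k , here refl , partners-full pk (∈T⇒kept p) (∈T⇒kept p′) }
      project-trail (cons e p j (cons e′ p′ j′ (cons e″ p″ j″ w))) (e∉ ∷ e′∉ ∷ U) x y refl eY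
        with cross j j′
      ... | i , k , k′ , refl , refl , refl , refl , inj₁ refl = ⊥-elim (All.lookup e∉ (here refl) refl)
      ... | i , k , k′ , refl , refl , refl , refl , inj₂ pk
        with project-trail (cons e″ p″ j″ w) U (corner i k′) y refl eY
      ...   | i′ , fs , W , U′ , witness =
        i , i′ ∷ fs , cons i (partners-∈proj pk p p′) (partners-join pk) W ,
        All.tabulate i∉ ∷ U′ , witness′
        where
        full-i = partners-full pk (∈T⇒kept p) (∈T⇒kept p′)
        i∉ : ∀ {j} → j ∈ₗ i′ ∷ fs → i ≡ j → ⊥
        i∉ j∈ refl with witness j∈
        ... | k″ , c∈ , f with full-side-edges pk (∈T⇒kept p) (∈T⇒kept p′) k″ f
        ...   | inj₁ refl = All.lookup e∉ (there c∈) refl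
        ...   | inj₂ refl = All.lookup e′∉ c∈ refl
        witness′ : ∀ {j} → j ∈ₗ i ∷ i′ ∷ fs →
                   ∃ λ k‴ → combine j k‴ ∈ₗ combine i k ∷ combine i k′ ∷ e″ ∷ _ × full j (side k‴) ≡ true
        witness′ (here refl) = k , here refl , full-i
        witness′ (there j∈) with witness j∈
        ... | k″ , c∈ , f = k″ , there (there c∈) , f

      -- A cycle is first restarted at an old vertex if it starts at a middle one.
      lift-acyclic : Acyclic G proj → Acyclic H T
      lift-acyclic acyclic (X , e , es , W , U) with vertex-view X
      ... | inj₁ (x , refl) with project-trail W U x x refl refl
      ...   | i , fs , W′ , U′ , _ = acyclic (x , i , fs , W′ , U′)
      lift-acyclic acyclic (X , e , es , W , U) | inj₂ (i , s , refl) with rotate W U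
      ... | z , e′ , es′ , W₂ , U₂ , j with leave-mid j
      ...   | k , refl , refl , refl with project-trail W₂ U₂ (corner i k) (corner i k) refl refl
      ...     | i′ , fs , W′ , U′ , _ = acyclic (corner i k , i′ , fs , W′ , U′)

  diamond-cycle : ∀ T i → full T i sideA ≡ true → full T i sideB ≡ true → HasCycle H T
  diamond-cycle T i f₀ f₁ with ∧-split f₀ | ∧-split f₁
  ... | b₀ , b₁ | b₂ , b₃ =
    old (corner i ua) , combine i ua , combine i av ∷ combine i vb ∷ combine i bu ∷ [] ,
    corner→mid T b₀ (mid→corner T b₁ (corner→mid T b₂ (mid→corner T b₃ nil))) ,
    (≢ (λ ()) ∷ ≢ (λ ()) ∷ ≢ (λ ()) ∷ []) ∷ (≢ (λ ()) ∷ ≢ (λ ()) ∷ []) ∷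
    (≢ (λ ()) ∷ []) ∷ [] ∷ []
    where
    ≢ : ∀ {k k′} → k ≢ k′ → combine i k ≢ combine i k′
    ≢ {k} {k′} k≢k′ eq = k≢k′ (combine-injectiveʳ i k i k′ eq)

  connected-touches : ∀ T → Connected H T → ∀ i h → touched T i h ≡ true
  connected-touches T conn i h = leaving (proj₂ (conn (mid i h) (old (corner i ua)))) refl refl
    where
    leaving : ∀ {X Y es} → Walk H T X Y es → X ≡ mid i h → Y ≡ old (corner i ua) →
              touched T i h ≡ true
    leaving nil eX eY = ⊥-elim (old≢mid (trans (sym eY) eX))
    leaving (cons e p j w) refl _ with leave-mid j
    ... | k , refl , refl , _ = kept⇒touched T i k (∈T⇒kept T p)

  tree-admissible : ∀ T → IsSpanningTree H T → ∀ i → admissible (window T i) ≡ true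
  tree-admissible T (conn , acyc) i =
    admissible-intro (kept T i) (λ f₀ f₁ → acyc (diamond-cycle T i f₀ f₁))
      (connected-touches T conn i sideA) (connected-touches T conn i sideB)

  reach-old : ∀ T → (∀ i → admissible (window T i) ≡ true) →
              ∀ X → ∃ λ x → ∃ λ es → Walk H T X (old x) es
  reach-old T adm X with vertex-view X
  ... | inj₁ (x , refl) = x , [] , nil
  ... | inj₂ (i , h , refl) with touched⇒kept T i h (admissible⇒touched T i (adm i) h)
  ...   | k , refl , b = corner i k , _ , mid→corner T b nil

  lift-connected : ∀ T → (∀ i → admissible (window T i) ≡ true) →
                   Connected G (proj T) → Connected H T
  lift-connected T adm conn X Y with reach-old T adm X | reach-old T adm Y
  ... | x , _ , X→x | y , _ , Y→y with lift-walk T (proj₂ (conn x y)) | reverseʷ Y→y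
  ...   | _ , x→y , _ | _ , y→Y = _ , X→x ++ʷ (x→y ++ʷ y→Y)

  project-tree : ∀ T → IsSpanningTree H T → IsSpanningTree G (proj T)
  project-tree T (conn , acyc) =
    (λ u v → project-walk T (proj₂ (conn (old u) (old v))) u v refl refl) ,
    (λ c → acyc (lift-cycle T c))

  lift-tree : ∀ T → (∀ i → admissible (window T i) ≡ true) →
              IsSpanningTree G (proj T) → IsSpanningTree H T
  lift-tree T adm (conn , acyc) =
    lift-connected T adm conn , lift-acyclic T (λ i → admissible-not-full (kept T i) (adm i)) acyc

  -- The inverse of T ↦ (proj T, codes T): in the diamond of i keep the quadruple
  -- decoded from the bit of i in S and the code of i.
  chosen : Subset nE → Vec (Fin 4) nE → Fin nE → Quad
  chosen S cs i = decode (lookup S i) (lookup cs i)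

  lift : Subset nE → Vec (Fin 4) nE → Subset (nE * 4)
  lift S cs = tabulate λ e → let (i , k) = remQuot {nE} 4 e in lookup (chosen S cs i) k

  codes : Subset (nE * 4) → Vec (Fin 4) nE
  codes T = tabulate λ i → code (window T i)

  window-lift : ∀ S cs i → window (lift S cs) i ≡ chosen S cs i
  window-lift S cs i = trans (tabulate-cong kept-lift) (tabulate∘lookup (chosen S cs i))
    where
    kept-lift : ∀ k → kept (lift S cs) i k ≡ lookup (chosen S cs i) k
    kept-lift k = trans (lookup∘tabulate _ (combine i k))
      (cong (λ (i , k) → lookup (chosen S cs i) k) (remQuot-combine {nE} {4} i k))

  proj-lift : ∀ S cs → proj (lift S cs) ≡ S
  proj-lift S cs = vec-ext λ i → begin
    lookup (proj (lift S cs)) i    ≡⟨ lookup∘tabulate _ i ⟩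
    carries (window (lift S cs) i) ≡⟨ cong carries (window-lift S cs i) ⟩
    carries (chosen S cs i)        ≡⟨ proj₁ (code-decode (lookup S i) (lookup cs i)) ⟩
    lookup S i                     ∎
    where open ≡-Reasoning

  codes-lift : ∀ S cs → codes (lift S cs) ≡ cs
  codes-lift S cs = vec-ext λ i → begin
    lookup (codes (lift S cs)) i ≡⟨ lookup∘tabulate _ i ⟩
    code (window (lift S cs) i)  ≡⟨ cong code (window-lift S cs i) ⟩
    code (chosen S cs i)         ≡⟨ proj₁ (proj₂ (code-decode (lookup S i) (lookup cs i))) ⟩
    lookup cs i                  ∎
    where open ≡-Reasoning

  lift-admissible : ∀ S cs i → admissible (window (lift S cs) i) ≡ true
  lift-admissible S cs i = trans (cong admissible (window-lift S cs i))
                                 (proj₂ (proj₂ (code-decode (lookup S i) (lookup cs i))))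

  lift-proj : ∀ T → (∀ i → admissible (window T i) ≡ true) → lift (proj T) (codes T) ≡ T
  lift-proj T adm = vec-ext λ e → same-diamond (combine-surjective {nE} {4} e)
    where
    open ≡-Reasoning
    T′ = lift (proj T) (codes T)
    same-window : ∀ i → window T′ i ≡ window T i
    same-window i = begin
      window T′ i                                       ≡⟨ window-lift (proj T) (codes T) i ⟩
      decode (lookup (proj T) i) (lookup (codes T) i)   ≡⟨ cong₂ decode (lookup∘tabulate _ i)
                                                                        (lookup∘tabulate _ i) ⟩
      decode (carries (window T i)) (code (window T i)) ≡⟨ decode-code (window T i) (adm i) ⟩
      window T i                                        ∎
    same-diamond : ∀ {e} → (∃₂ λ i k → combine i k ≡ e) → lookup T′ e ≡ lookup T e
    same-diamond (i , k , refl) = begin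
      kept T′ i k            ≡⟨ lookup∘tabulate (kept T′ i) k ⟨
      lookup (window T′ i) k ≡⟨ cong (λ w → lookup w k) (same-window i) ⟩
      lookup (window T i) k  ≡⟨ lookup∘tabulate (kept T i) k ⟩
      kept T i k             ∎

  spanning-trees : SpanningTree H ↔ (SpanningTree G × Vec (Fin 4) nE)
  spanning-trees = mk↔ₛ′ to from to∘from from∘to
    where
    to : SpanningTree H → SpanningTree G × Vec (Fin 4) nE
    to (T ,ʳ t) = (proj T ,ʳ mapIrr (project-tree T) t) , codes T
    from : SpanningTree G × Vec (Fin 4) nE → SpanningTree H
    from ((S ,ʳ s) , cs) = lift S cs ,ʳ mapIrr lifted s
      where
      lifted : IsSpanningTree G S → IsSpanningTree H (lift S cs)
      lifted s = lift-tree (lift S cs) (lift-admissible S cs)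
                           (subst (IsSpanningTree G) (sym (proj-lift S cs)) s)
    to∘from : ∀ y → to (from y) ≡ y
    to∘from ((S ,ʳ _) , cs) = cong₂ _,_ (value-injective (proj-lift S cs)) (codes-lift S cs)
    -- admissibility is a decidable fact, so it can be recovered from the irrelevant proof
    from∘to : ∀ x → from (to x) ≡ x
    from∘to (T ,ʳ [ t ]) = value-injective (lift-proj T λ i →
      recompute (admissible (window T i) ≟ᵇ true) (tree-admissible T t i))

module SingleEdge where
  edge : Subset 1
  edge = true ∷ []

  edge-tree : IsSpanningTree (V 0) edge
  edge-tree = connected , acyclic
    where
    e∈edge : zero ∈ edge
    e∈edge = lookup⇒[]= zero edge refl
    connected : Connected (V 0) edge
    connected zero       zero       = [] , nil
    connected zero       (suc zero) = _ , cons zero e∈edge (inj₁ refl) nil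
    connected (suc zero) zero       = _ , cons zero e∈edge (inj₂ refl) nil
    connected (suc zero) (suc zero) = [] , nil
    -- a loop would need equal endpoints; a longer cycle would reuse the edge
    acyclic : Acyclic (V 0) edge
    acyclic (_ , zero , [] , cons _ _ (inj₁ eq) nil , _) with ,-injective eq
    ... | refl , ()
    acyclic (_ , zero , [] , cons _ _ (inj₂ eq) nil , _) with ,-injective eq
    ... | refl , ()
    acyclic (_ , zero , zero ∷ _ , _ , (e≢e ∷ _) ∷ _) = e≢e refl

  tree-is-edge : ∀ b → IsSpanningTree (V 0) (b ∷ []) → b ≡ true
  tree-is-edge true  _               = refl
  tree-is-edge false (connected , _) = ⊥-elim (no-walk (proj₂ (connected zero (suc zero))) refl refl)
    where
    no-walk : ∀ {X Y es} → Walk (V 0) (false ∷ []) X Y es → X ≡ zero → Y ≡ suc zero → ⊥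
    no-walk nil             refl ()
    no-walk (cons zero p _ _) _  _ with []=⇒lookup p
    ... | ()

  single-edge : SpanningTree (V 0) ↔ Fin 1
  single-edge = mk↔ₛ′ (λ _ → zero) (λ _ → edge ,ʳ [ edge-tree ]) (λ { zero → refl }) unique
    where
    unique : ∀ t → (edge ,ʳ [ edge-tree ]) ≡ t
    unique ((b ∷ []) ,ʳ [ t ]) =
      value-injective (cong (_∷ []) (sym (recompute (b ≟ᵇ true) (tree-is-edge b t))))

vectors : ∀ n → Vec (Fin 4) n ↔ Fin (4 ^ n)
vectors zero    = mk↔ₛ′ (λ _ → zero) (λ _ → []) (λ { zero → refl }) (λ { [] → refl })
vectors (suc n) = ↔-trans uncons (↔-trans (↔-refl ×-↔ vectors n) (↔-sym (*↔× {4} {4 ^ n})))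
  where
  uncons : Vec (Fin 4) (suc n) ↔ (Fin 4 × Vec (Fin 4) n)
  uncons = mk↔ₛ′ (λ { (x ∷ xs) → x , xs }) (λ { (x , xs) → x ∷ xs })
                 (λ _ → refl) (λ { (x ∷ xs) → refl })

-- τ(V n) = 2 ^ exponent n, where each substitution step multiplies by 4 ^ numE n.
exponent : ℕ → ℕ
exponent zero    = 0
exponent (suc n) = exponent n + 2 * numE n

spanning-trees-V : ∀ n → SpanningTree (V n) ↔ Fin (2 ^ exponent n)
spanning-trees-V zero    = SingleEdge.single-edge
spanning-trees-V (suc n) =
  ↔-trans (Substitution.spanning-trees (V n))
  (↔-trans (spanning-trees-V n ×-↔ vectors (numE n))
  (↔-trans (↔-sym (*↔× {2 ^ exponent n} {4 ^ numE n}))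
           (subst (λ k → Fin (2 ^ exponent n * 4 ^ numE n) ↔ Fin k) powers ↔-refl)))
  where
  powers : 2 ^ exponent n * 4 ^ numE n ≡ 2 ^ exponent (suc n)
  powers = sym (trans (^-distribˡ-+-* 2 (exponent n) (2 * numE n))
                      (cong (2 ^ exponent n *_) (sym (^-*-assoc 2 2 (numE n)))))

numE-closed : ∀ n → numE n ≡ 4 ^ n
numE-closed zero    = refl
numE-closed (suc n) = trans (*-comm (numE n) 4) (cong (4 *_) (numE-closed n))

exponent-closed : ∀ n → exponent n * 3 + 2 ≡ 2 * 4 ^ n
exponent-closed zero    = refl
exponent-closed (suc n) rewrite numE-closed n = begin
  (exponent n + 2 * 4 ^ n) * 3 + 2  ≡⟨ regroup (exponent n) (4 ^ n) ⟩
  (exponent n * 3 + 2) + 6 * 4 ^ n  ≡⟨ cong (_+ 6 * 4 ^ n) (exponent-closed n) ⟩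
  2 * 4 ^ n + 6 * 4 ^ n             ≡⟨ collect (4 ^ n) ⟩
  2 * (4 * 4 ^ n)                   ∎
  where
  open ≡-Reasoning
  open +-*-Solver
  regroup : ∀ x y → (x + 2 * y) * 3 + 2 ≡ (x * 3 + 2) + 6 * y
  regroup = solve 2 (λ x y → (x :+ con 2 :* y) :* con 3 :+ con 2
                            := (x :* con 3 :+ con 2) :+ con 6 :* y) refl
  collect : ∀ y → 2 * y + 6 * y ≡ 2 * (4 * y)
  collect = solve 1 (λ y → con 2 :* y :+ con 6 :* y := con 2 :* (con 4 :* y)) refl

exponent≡ : ∀ n → 2 * (4 ^ n ∸ 1) / 3 ≡ exponent n
exponent≡ n = begin
  2 * (4 ^ n ∸ 1) / 3          ≡⟨ cong (_/ 3) (*-distribˡ-∸ 2 (4 ^ n) 1) ⟩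
  (2 * 4 ^ n ∸ 2) / 3          ≡⟨ cong (λ m → (m ∸ 2) / 3) (sym (exponent-closed n)) ⟩
  (exponent n * 3 + 2 ∸ 2) / 3 ≡⟨ cong (_/ 3) (m+n∸n≡m (exponent n * 3) 2) ⟩
  exponent n * 3 / 3           ≡⟨ m*n/n≡m (exponent n) 3 ⟩
  exponent n                   ∎
  where open ≡-Reasoning

-- Theorem 5.7 (the formula holds for n = 0 as well).
theorem5p7 : (n : ℕ) → 1 ≤ n → τ≡ (V n) (2 ^ (2 * (4 ^ n ∸ 1) / 3))
theorem5p7 n _ = subst (λ k → τ≡ (V n) (2 ^ k)) (sym (exponent≡ n)) (spanning-trees-V n)
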